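{- ${\rm gp_e}(\Lambda_5)=7$.
   Context: The Lucas cube $\Lambda_5$ is the graph whose vertices are the binary strings of length $5$ with no two consecutive 1s and not both starting and ending with 1, two vertices being adjacent iff they differ in exactly one coordinate. A set of edges $X\subseteq E(G)$ is an edge general position set of a graph $G$ if no three edges of $X$ lie on a common shortest path of $G$; ${\rm gp_e}(G)$ is the maximum cardinality of an edge general position set of $G$. -}

module Defs where

open import Data.Bool using (Bool; true; false; T; _∧_; not; if_then_else_; _xor_)
open import Data.Nat using (ℕ; zero; suc; _+_; _≤_)
open import Data.Vec using (Vec; []; _∷_; head; last)
open import Data.List using (List; length; lookup)
open import Data.List.Relation.Unary.AllPairs using (AllPairs)
open import Data.Fin using (Fin)
open import Data.Product using (Σ; _×_; _,_; ∃; proj₁)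
open import Data.Sum using (_⊎_)
open import Relation.Binary.PropositionalEquality using (_≡_; _≢_)
open import Relation.Nullary using (¬_)

module Graph {V : Set} (Adj : V → V → Set) where

  data Walk : V → V → Set where
    []  : ∀ {u} → Walk u u
    _∷_ : ∀ {u w v} → Adj u w → Walk w v → Walk u v

  len : ∀ {u v} → Walk u v → ℕ
  len []      = 0
  len (_ ∷ p) = suc (len p)

  IsShortest : ∀ {u v} → Walk u v → Set
  IsShortest {u} {v} p = ∀ (q : Walk u v) → len p ≤ len q

  Edge : Set
  Edge = Σ (V × V) λ { (a , b) → Adj a b }

  SameEdge : Edge → Edge → Set
  SameEdge ((a , b) , _) ((c , d) , _) = (a ≡ c × b ≡ d) ⊎ (a ≡ d × b ≡ c)

  data Traverses (a b : V) : ∀ {u v} → Walk u v → Set where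
    here  : ∀ {w v} (e : Adj a w) (p : Walk w v) → w ≡ b → Traverses a b (e ∷ p)
    there : ∀ {u w v} (e : Adj u w) (p : Walk w v) → Traverses a b p → Traverses a b (e ∷ p)

  OnWalk : Edge → ∀ {u v} → Walk u v → Set
  OnWalk ((a , b) , _) p = Traverses a b p ⊎ Traverses b a p

  EdgeSet : Set
  EdgeSet = Σ (List Edge) (AllPairs (λ e f → ¬ SameEdge e f))

  card : EdgeSet → ℕ
  card (X , _) = length X

  IsEdgeGP : EdgeSet → Set
  IsEdgeGP (X , _) =
    ∀ (i j k : Fin (length X)) → i ≢ j → j ≢ k → i ≢ k →
    ¬ (Σ V λ u → Σ V λ v → Σ (Walk u v) λ p →
         IsShortest p × OnWalk (lookup X i) p × OnWalk (lookup X j) p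
                      × OnWalk (lookup X k) p)

  GpE≡ : ℕ → Set
  GpE≡ n = (Σ EdgeSet λ X → IsEdgeGP X × card X ≡ n)
         × (∀ (X : EdgeSet) → IsEdgeGP X → card X ≤ n)

noAdj11 : ∀ {n} → Vec Bool n → Bool
noAdj11 []                    = true
noAdj11 (x ∷ [])              = true
noAdj11 (true ∷ true ∷ xs)    = false
noAdj11 (_ ∷ y ∷ xs)          = noAdj11 (y ∷ xs)

notBoth1 : ∀ {n} → Vec Bool (suc n) → Bool
notBoth1 xs = not (head xs ∧ last xs)

isLucas : ∀ {n} → Vec Bool (suc n) → Bool
isLucas xs = noAdj11 xs ∧ notBoth1 xs

LucasVertex : ℕ → Set
LucasVertex n = Σ (Vec Bool (suc n)) λ xs → T (isLucas xs)

hamming : ∀ {n} → Vec Bool n → Vec Bool n → ℕ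
hamming []       []       = 0
hamming (x ∷ xs) (y ∷ ys) = (if x xor y then 1 else 0) + hamming xs ys

LucasAdj : ∀ {n} → LucasVertex n → LucasVertex n → Set
LucasAdj (x , _) (y , _) = hamming x y ≡ 1

-- Λ_5 : vertices are binary strings of length 5 = suc 4
Λ₅Adj : LucasVertex 4 → LucasVertex 4 → Set
Λ₅Adj = LucasAdj

module Submission where

-- Turning 1s into 0s keeps a string Lucas, so a geodesic of the hypercube between
-- x and y through their meet x ∧ y stays inside Λₙ: distances in Λₙ are Hamming
-- distances. Hence a walk traversing arcs (x₁,y₁), (x₂,y₂), (x₃,y₃) in this order is
-- a geodesic only if 3 + d(y₁,x₂) + d(y₂,x₃) ≤ d(x₁,y₃).
--
-- Λ₅ is the centre 00000, its five neighbours of weight one, and five strings of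
-- weight two which close the weight-one vertices into a 10-cycle. The three spokes to
-- 00001, 00010, 00100 and the edges 01000–01001, 01000–01010, 10000–10010,
-- 10000–10100 admit no orientation and order satisfying the inequality above, so
-- they are in edge general position. Conversely, take the 20 geodesics of length 4
-- between weight-two vertices through the centre and the 5 along the 10-cycle, the
-- latter counted twice: every edge lies on 8 of these 30 geodesics, and each of them
-- carries at most two edges of a general position set X, so 8 ∣X∣ ≤ 60.

open import Defs
open import Data.Nat using (ℕ)

open import Data.Bool using (Bool; true; false; T; _∧_; not; if_then_else_; _xor_)
import Data.Bool as 𝔹
open import Data.Bool.Properties using (T-irrelevant; T-∧)
open import Data.Empty using (⊥-elim)
open import Data.Fin using (Fin; zero; suc)
import Data.Fin.Properties as Fin
open import Data.List as List using (List; []; _∷_; _++_; lookup)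
open import Data.List.Membership.Propositional using (_∈_; find; lose)
open import Data.List.Membership.Propositional.Properties using (∈-map⁻; ∈-concatMap⁻; ∈-lookup)
open import Data.List.Relation.Binary.Permutation.Propositional using (_↭_; ↭-refl; ↭-prep; ↭-swap; ↭-trans)
open import Data.List.Relation.Binary.Permutation.Propositional.Properties using (∈-resp-↭)
open import Data.List.Relation.Unary.All as All using (All; []; _∷_)
open import Data.List.Relation.Unary.AllPairs using (AllPairs; []; _∷_; allPairs?)
open import Data.List.Relation.Unary.Any as Any using (Any; here; there)
import Data.List.Relation.Unary.Any.Properties as Any
open import Data.Nat using (zero; suc; _+_; _*_; _≤_; z≤n; s≤s; s≤s⁻¹; _≤?_; _<?_; _≡ᵇ_) renaming (_≟_ to _≟ℕ_)
open import Data.Nat.ListAction using (sum)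
open import Data.Nat.Properties
open import Algebra.Properties.CommutativeSemigroup +-commutativeSemigroup using (interchange)
open import Data.Product using (Σ; _×_; _,_; proj₁; proj₂)
open import Data.Sum as Sum using (_⊎_; inj₁; inj₂)
open import Data.Unit using (⊤; tt)
open import Data.Vec using (Vec; []; _∷_; zipWith; last)
import Data.Vec.Properties as Vec
open import Data.Vec.Functional using () renaming (_∷_ to _∷ᶠ_)
open import Data.Vec.Relation.Binary.Pointwise.Inductive using (Pointwise; []; _∷_)
open import Function using (_∘_; _∋_; case_of_)
open import Function.Bundles using (Equivalence)
open import Function.Definitions using (Injective)
open import Relation.Binary.Definitions using (DecidableEquality)
open import Relation.Binary.PropositionalEquality
  using (_≡_; _≢_; refl; sym; trans; cong; cong₂; subst; module ≡-Reasoning)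
open import Relation.Nullary using (¬_; Dec; yes; no)
open import Relation.Nullary.Decidable using (map′; _×-dec_; _⊎-dec_; _→-dec_; ¬?; T?; from-yes)
open import Relation.Nullary.Irrelevant using (Irrelevant)

module _ {A : Set} where

  insertions : A → List A → List (List A)
  insertions x []       = (x ∷ []) ∷ []
  insertions x (y ∷ ys) = (x ∷ y ∷ ys) ∷ List.map (y ∷_) (insertions x ys)

  orderings : List A → List (List A)
  orderings []       = [] ∷ []
  orderings (x ∷ xs) = List.concatMap (insertions x) (orderings xs)

  insertions-↭ : ∀ x ys {zs} → zs ∈ insertions x ys → zs ↭ x ∷ ys
  insertions-↭ x []       (here refl) = ↭-refl
  insertions-↭ x (y ∷ ys) (here refl) = ↭-refl
  insertions-↭ x (y ∷ ys) (there zs∈)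
    with zs′ , zs′∈ , refl ← ∈-map⁻ (y ∷_) zs∈
    = ↭-trans (↭-prep y (insertions-↭ x ys zs′∈)) (↭-swap y x ↭-refl)

  orderings-↭ : ∀ xs {ys} → ys ∈ orderings xs → ys ↭ xs
  orderings-↭ []       (here refl) = ↭-refl
  orderings-↭ (x ∷ xs) ys∈
    with zs , zs∈ , ys∈′ ← find (∈-concatMap⁻ (insertions x) ys∈)
    = ↭-trans (insertions-↭ x zs ys∈′) (↭-prep x (orderings-↭ xs zs∈))

  allPairs-lookup : ∀ {R : A → A → Set} → (∀ {x y} → R x y → R y x) →
                    ∀ {xs} → AllPairs R xs → ∀ {i j} → i ≢ j → R (lookup xs i) (lookup xs j)
  allPairs-lookup sym (rx ∷ rxs) {zero}  {zero}  i≢j = ⊥-elim (i≢j refl)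
  allPairs-lookup sym (rx ∷ rxs) {zero}  {suc j} _   = All.lookup rx (∈-lookup j)
  allPairs-lookup sym (rx ∷ rxs) {suc i} {zero}  _   = sym (All.lookup rx (∈-lookup i))
  allPairs-lookup sym (rx ∷ rxs) {suc i} {suc j} i≢j = allPairs-lookup sym rxs (i≢j ∘ cong suc)

⟦_⟧ : ∀ {P : Set} → Dec P → ℕ
⟦ yes _ ⟧ = 1
⟦ no  _ ⟧ = 0

count : ∀ {A : Set} {P : A → Set} → (∀ x → Dec (P x)) → List A → ℕ
count P? xs = sum (List.map (λ x → ⟦ P? x ⟧) xs)

count≤ : ∀ {A : Set} {P : A → Set} (P? : ∀ x → Dec (P x)) k (xs : List A) →
         (∀ (f : Fin (suc k) → Fin (List.length xs)) → Injective _≡_ _≡_ f → ¬ (∀ i → P (lookup xs (f i)))) →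
         count P? xs ≤ k
count≤ P? k       []       none = z≤n
count≤ P? k       (x ∷ xs) none with P? x
count≤ P? k       (x ∷ xs) none | no ¬px =
  count≤ P? k xs (λ f f-inj Pf → none (suc ∘ f) (f-inj ∘ Fin.suc-injective) Pf)
count≤ P? zero    (x ∷ xs) none | yes px =
  ⊥-elim (none (λ _ → zero) (λ { {zero} {zero} _ → refl }) (λ { zero → px }))
count≤ P? (suc k) (x ∷ xs) none | yes px =
  s≤s (count≤ P? k xs λ f f-inj Pf →
         none (zero ∷ᶠ suc ∘ f) (cons-injective f-inj) (λ { zero → px ; (suc i) → Pf i }))
  where
  cons-injective : ∀ {n} {f : Fin (suc k) → Fin n} →
                   Injective _≡_ _≡_ f → Injective _≡_ _≡_ (zero ∷ᶠ suc ∘ f)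
  cons-injective f-inj {zero}  {zero}  _  = refl
  cons-injective f-inj {suc i} {suc j} eq = cong suc (f-inj (Fin.suc-injective eq))

sum-map-+ : ∀ {A : Set} (f g : A → ℕ) xs →
            sum (List.map (λ x → f x + g x) xs) ≡ sum (List.map f xs) + sum (List.map g xs)
sum-map-+ f g []       = refl
sum-map-+ f g (x ∷ xs) = trans (cong (f x + g x +_) (sum-map-+ f g xs))
                               (interchange (f x) (g x) (sum (List.map f xs)) (sum (List.map g xs)))

sum-map-zero : ∀ {A : Set} (xs : List A) → sum (List.map (λ _ → 0) xs) ≡ 0
sum-map-zero []       = refl
sum-map-zero (x ∷ xs) = sum-map-zero xs

sum-map-comm : ∀ {A B : Set} (f : A → B → ℕ) xs ys →
               sum (List.map (λ x → sum (List.map (f x) ys)) xs) ≡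
               sum (List.map (λ y → sum (List.map (λ x → f x y) xs)) ys)
sum-map-comm f []       ys = sym (sum-map-zero ys)
sum-map-comm f (x ∷ xs) ys = trans (cong (sum (List.map (f x) ys) +_) (sum-map-comm f xs ys))
                                   (sym (sum-map-+ (f x) _ ys))

length*≤sum-map : ∀ {A : Set} {k} (f : A → ℕ) → (∀ x → k ≤ f x) → ∀ xs →
                  List.length xs * k ≤ sum (List.map f xs)
length*≤sum-map f k≤f []       = z≤n
length*≤sum-map f k≤f (x ∷ xs) = +-mono-≤ (k≤f x) (length*≤sum-map f k≤f xs)

sum-map≤length* : ∀ {A : Set} {k} (f : A → ℕ) {xs} → All (λ x → f x ≤ k) xs →
                  sum (List.map f xs) ≤ List.length xs * k
sum-map≤length* f []           = z≤n
sum-map≤length* f (fx≤k ∷ f≤k) = +-mono-≤ fx≤k (sum-map≤length* f f≤k)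

Π? : ∀ {P : Set} {Q : P → Set} → Dec P → Irrelevant P → (∀ x → Dec (Q x)) → Dec (∀ x → Q x)
Π? {Q = Q} (yes x) irr Q? = map′ (λ q x′ → subst Q (irr x x′) q) (λ h → h x) (Q? x)
Π?         (no ¬x) _   _  = yes (λ x → ⊥-elim (¬x x))

∀-Vec? : ∀ {m} {Q : Vec Bool m → Set} → (∀ x → Dec (Q x)) → Dec (∀ x → Q x)
∀-Vec? {zero}  Q? = map′ (λ { q [] → q }) (λ h → h []) (Q? [])
∀-Vec? {suc m} Q? =
  map′ (λ { (f , t) (false ∷ x) → f x ; (f , t) (true ∷ x) → t x })
       (λ h → h ∘ (false ∷_) , h ∘ (true ∷_))
       (∀-Vec? (Q? ∘ (false ∷_)) ×-dec ∀-Vec? (Q? ∘ (true ∷_)))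

module _ {V : Set} {Adj : V → V → Set} where
  open Graph Adj

  record Route : Set where
    constructor ⟨_⟩
    field
      {start end} : V
      walk        : Walk start end

  SameEdge-sym : ∀ e f → SameEdge e f → SameEdge f e
  SameEdge-sym _ _ (inj₁ (refl , refl)) = inj₁ (refl , refl)
  SameEdge-sym _ _ (inj₂ (refl , refl)) = inj₂ (refl , refl)

  infixr 5 _++ʷ_

  _++ʷ_ : ∀ {u v w} → Walk u v → Walk v w → Walk u w
  []      ++ʷ q = q
  (e ∷ p) ++ʷ q = e ∷ (p ++ʷ q)

  len-++ʷ : ∀ {u v w} (p : Walk u v) (q : Walk v w) → len (p ++ʷ q) ≡ len p + len q
  len-++ʷ []      q = refl
  len-++ʷ (e ∷ p) q = cong suc (len-++ʷ p q)

  reverseʷ : (∀ u v → Adj u v → Adj v u) → ∀ {u v} → Walk u v → Walk v u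
  reverseʷ sym []                = []
  reverseʷ sym (_∷_ {u} {w} e p) = reverseʷ sym p ++ʷ (sym u w e ∷ [])

  len-reverseʷ : (sym : ∀ u v → Adj u v → Adj v u) → ∀ {u v} (p : Walk u v) → len (reverseʷ sym p) ≡ len p
  len-reverseʷ sym []      = refl
  len-reverseʷ sym (e ∷ p) = begin
    len (reverseʷ sym p ++ʷ _)  ≡⟨ len-++ʷ (reverseʷ sym p) _ ⟩
    len (reverseʷ sym p) + 1    ≡⟨ cong (_+ 1) (len-reverseʷ sym p) ⟩
    len p + 1                   ≡⟨ +-comm (len p) 1 ⟩
    suc (len p)                 ∎
    where open ≡-Reasoning

  data TraversesInOrder : ∀ {u v} → List (V × V) → Walk u v → Set where
    []   : ∀ {u v} {p : Walk u v} → TraversesInOrder [] p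
    skip : ∀ {u w v L} {e : Adj u w} {p : Walk w v} → TraversesInOrder L p → TraversesInOrder L (e ∷ p)
    take : ∀ {u w v L} {e : Adj u w} {p : Walk w v} → TraversesInOrder L p → TraversesInOrder ((u , w) ∷ L) (e ∷ p)

  inOrder-single : ∀ {a b u v} {p : Walk u v} → Traverses a b p → TraversesInOrder ((a , b) ∷ []) p
  inOrder-single (here e p refl) = take []
  inOrder-single (there e p t)   = skip (inOrder-single t)

  inOrder-insert : ∀ {a b u v L} {p : Walk u v} → Traverses a b p → TraversesInOrder L p →
                   (a , b) ∈ L ⊎ Any (λ L′ → TraversesInOrder L′ p) (insertions (a , b) L)
  inOrder-insert t                          []        = inj₂ (here (inOrder-single t))
  inOrder-insert {L = []}    (here e p refl) (skip ts) = inj₂ (here (take ts))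
  inOrder-insert {L = _ ∷ _} (here e p refl) (skip ts) = inj₂ (here (take ts))
  inOrder-insert             (here e p refl) (take ts) = inj₁ (here refl)
  inOrder-insert             (there e p t)   (skip ts) = Sum.map₂ (Any.map skip) (inOrder-insert t ts)
  inOrder-insert             (there e p t)   (take ts) with inOrder-insert t ts
  ... | inj₁ ab∈L = inj₁ (there ab∈L)
  ... | inj₂ ins  = inj₂ (there (Any.map⁺ (Any.map take ins)))

  inOrder-some-ordering : ∀ {u v L} {p : Walk u v} →
                          All (λ (a , b) → Traverses a b p) L → AllPairs _≢_ L →
                          Any (λ L′ → TraversesInOrder L′ p) (orderings L)
  inOrder-some-ordering []       []           = here []
  inOrder-some-ordering {L = x ∷ xs} (t ∷ ts) (x∉xs ∷ distinct)
    with L′ , L′∈ , ts′ ← find (inOrder-some-ordering ts distinct)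
    = case inOrder-insert t ts′ of λ
        { (inj₁ x∈L′) → ⊥-elim (All.lookup x∉xs (∈-resp-↭ (orderings-↭ xs L′∈) x∈L′) refl)
        ; (inj₂ ins)  → Any.concat⁺ (Any.map⁺ (lose L′∈ ins)) }

module _ {V W : Set} {A : V → V → Set} {B : W → W → Set}
         (f : V → W) (f-adj : ∀ {u v} → A u v → B (f u) (f v)) where
  private
    module GA = Graph A
    module GB = Graph B

  mapʷ : ∀ {u v} → GA.Walk u v → GB.Walk (f u) (f v)
  mapʷ GA.[]      = GB.[]
  mapʷ (e GA.∷ p) = f-adj e GB.∷ mapʷ p

  len-mapʷ : ∀ {u v} (p : GA.Walk u v) → GB.len (mapʷ p) ≡ GA.len p
  len-mapʷ GA.[]      = refl
  len-mapʷ (e GA.∷ p) = cong suc (len-mapʷ p)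

module _ {V : Set} {Adj : V → V → Set} (_≟_ : DecidableEquality V) where
  open Graph Adj

  traverses? : ∀ a b {u v} (q : Walk u v) → Dec (Traverses a b q)
  traverses? a b []                = no λ ()
  traverses? a b (_∷_ {u} {w} e q) with u ≟ a | w ≟ b | traverses? a b q
  ... | yes refl | yes w≡b | _     = yes (here e q w≡b)
  ... | _        | _       | yes t = yes (there e q t)
  ... | no u≢a   | _       | no ¬t = no λ { (here _ _ _) → u≢a refl ; (there _ _ t) → ¬t t }
  ... | yes _    | no w≢b  | no ¬t = no λ { (here _ _ w≡b) → w≢b w≡b ; (there _ _ t) → ¬t t }

  onWalk? : ∀ e {u v} (q : Walk u v) → Dec (OnWalk e q)
  onWalk? ((a , b) , _) q = traverses? a b q ⊎-dec traverses? b a q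

  sameEdge? : ∀ e f → Dec (SameEdge e f)
  sameEdge? ((a , b) , _) ((c , d) , _) = (a ≟ c ×-dec b ≟ d) ⊎-dec (a ≟ d ×-dec b ≟ c)

  edgeGP-count≤2 : (X : EdgeSet) → IsEdgeGP X → ∀ {u v} (q : Walk u v) → IsShortest q →
                   count (λ e → onWalk? e q) (proj₁ X) ≤ 2
  edgeGP-count≤2 (X , _) gp q shortest = count≤ (λ e → onWalk? e q) 2 X λ f f-inj on →
    gp (f 0F) (f 1F) (f 2F) (λ eq → 0≢1 (f-inj eq)) (λ eq → 1≢2 (f-inj eq)) (λ eq → 0≢2 (f-inj eq))
       (_ , _ , q , shortest , on 0F , on 1F , on 2F)
    where
    0F 1F 2F : Fin 3
    0F = zero
    1F = suc zero
    2F = suc (suc zero)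
    0≢1 : 0F ≢ 1F
    0≢1 ()
    1≢2 : 1F ≢ 2F
    1≢2 ()
    0≢2 : 0F ≢ 2F
    0≢2 ()

  cover-bound : (F : List (Route {Adj = Adj})) → All (IsShortest ∘ Route.walk) F →
                ∀ {c} → (∀ e → c ≤ count (λ r → onWalk? e (Route.walk r)) F) →
                (X : EdgeSet) → IsEdgeGP X → card X * c ≤ List.length F * 2
  cover-bound F shortest {c} covered X gp = begin
    List.length (proj₁ X) * c
      ≤⟨ length*≤sum-map _ covered (proj₁ X) ⟩
    sum (List.map (λ e → count (λ r → onWalk? e (Route.walk r)) F) (proj₁ X))
      ≡⟨ sum-map-comm (λ e r → ⟦ onWalk? e (Route.walk r) ⟧) (proj₁ X) F ⟩
    sum (List.map (λ r → count (λ e → onWalk? e (Route.walk r)) (proj₁ X)) F)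
      ≤⟨ sum-map≤length* _ (All.map (λ {r} → edgeGP-count≤2 X gp (Route.walk r)) shortest) ⟩
    List.length F * 2
      ∎
    where open ≤-Reasoning

-- Subgraphs of the hypercube

δ : Bool → Bool → ℕ
δ a b = if a xor b then 1 else 0

hamming-self : ∀ {m} (x : Vec Bool m) → hamming x x ≡ 0
hamming-self []           = refl
hamming-self (false ∷ xs) = hamming-self xs
hamming-self (true  ∷ xs) = hamming-self xs

hamming-∷-self : ∀ {m} b (xs ys : Vec Bool m) → hamming (b ∷ xs) (b ∷ ys) ≡ hamming xs ys
hamming-∷-self false xs ys = refl
hamming-∷-self true  xs ys = refl

hamming-sym : ∀ {m} (x y : Vec Bool m) → hamming x y ≡ hamming y x
hamming-sym []       []       = refl
hamming-sym (x ∷ xs) (y ∷ ys) = cong₂ _+_ (δ-sym x y) (hamming-sym xs ys)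
  where
  δ-sym : ∀ a b → δ a b ≡ δ b a
  δ-sym false false = refl
  δ-sym false true  = refl
  δ-sym true  false = refl
  δ-sym true  true  = refl

hamming-triangle : ∀ {m} (x y z : Vec Bool m) → hamming x z ≤ hamming x y + hamming y z
hamming-triangle []       []       []       = z≤n
hamming-triangle (x ∷ xs) (y ∷ ys) (z ∷ zs) =
  ≤-trans (+-mono-≤ (δ-triangle x y z) (hamming-triangle xs ys zs))
          (≤-reflexive (interchange (δ x y) (δ y z) (hamming xs ys) (hamming ys zs)))
  where
  δ-triangle : ∀ a b c → δ a c ≤ δ a b + δ b c
  δ-triangle false false false = z≤n
  δ-triangle false false true  = s≤s z≤n
  δ-triangle false true  false = z≤n
  δ-triangle false true  true  = s≤s z≤n
  δ-triangle true  false false = s≤s z≤n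
  δ-triangle true  false true  = z≤n
  δ-triangle true  true  false = s≤s z≤n
  δ-triangle true  true  true  = z≤n

hamming-meet : ∀ {m} (x y : Vec Bool m) →
               hamming (zipWith _∧_ x y) x + hamming (zipWith _∧_ x y) y ≡ hamming x y
hamming-meet []       []       = refl
hamming-meet (x ∷ xs) (y ∷ ys) = begin
  (δ (x ∧ y) x + hamming z xs) + (δ (x ∧ y) y + hamming z ys)
    ≡⟨ interchange (δ (x ∧ y) x) (hamming z xs) (δ (x ∧ y) y) (hamming z ys) ⟩
  (δ (x ∧ y) x + δ (x ∧ y) y) + (hamming z xs + hamming z ys)
    ≡⟨ cong₂ _+_ (δ-meet x y) (hamming-meet xs ys) ⟩
  δ x y + hamming xs ys
    ∎
  where
  open ≡-Reasoning
  z : Vec Bool _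
  z = zipWith _∧_ xs ys
  δ-meet : ∀ a b → δ (a ∧ b) a + δ (a ∧ b) b ≡ δ a b
  δ-meet false false = refl
  δ-meet false true  = refl
  δ-meet true  false = refl
  δ-meet true  true  = refl

_≤ᵛ_ : ∀ {m} → Vec Bool m → Vec Bool m → Set
_≤ᵛ_ = Pointwise 𝔹._≤_

meet≤ˡ : ∀ {m} (x y : Vec Bool m) → zipWith _∧_ x y ≤ᵛ x
meet≤ˡ []           []           = []
meet≤ˡ (false ∷ xs) (y     ∷ ys) = 𝔹.b≤b ∷ meet≤ˡ xs ys
meet≤ˡ (true  ∷ xs) (false ∷ ys) = 𝔹.f≤t ∷ meet≤ˡ xs ys
meet≤ˡ (true  ∷ xs) (true  ∷ ys) = 𝔹.b≤b ∷ meet≤ˡ xs ys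

meet≤ʳ : ∀ {m} (x y : Vec Bool m) → zipWith _∧_ x y ≤ᵛ y
meet≤ʳ []           []           = []
meet≤ʳ (false ∷ xs) (false ∷ ys) = 𝔹.b≤b ∷ meet≤ʳ xs ys
meet≤ʳ (false ∷ xs) (true  ∷ ys) = 𝔹.f≤t ∷ meet≤ʳ xs ys
meet≤ʳ (true  ∷ xs) (y     ∷ ys) = 𝔹.b≤b ∷ meet≤ʳ xs ys

DownClosed : ∀ {m} → (Vec Bool m → Bool) → Set
DownClosed p = ∀ {x y} → x ≤ᵛ y → T (p y) → T (p x)

InducedVertex : ∀ {m} → (Vec Bool m → Bool) → Set
InducedVertex {m} p = Σ (Vec Bool m) (T ∘ p)

InducedAdj : ∀ {m} (p : Vec Bool m → Bool) → InducedVertex p → InducedVertex p → Set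
InducedAdj p u v = hamming (proj₁ u) (proj₁ v) ≡ 1

consʷ : ∀ {m} {p : Vec Bool (suc m) → Bool} b {u v} →
        Graph.Walk (InducedAdj (p ∘ (b ∷_))) u v →
        Graph.Walk (InducedAdj p) (b ∷ proj₁ u , proj₂ u) (b ∷ proj₁ v , proj₂ v)
consʷ b = mapʷ (λ v → b ∷ proj₁ v , proj₂ v) (λ {u} {v} e → trans (hamming-∷-self b (proj₁ u) (proj₁ v)) e)

-- Flips, left to right, the coordinates where x and y differ; every intermediate string lies below y.
climb : ∀ {m} {p : Vec Bool m → Bool} → DownClosed p →
        ∀ {x y} → x ≤ᵛ y → (px : T (p x)) (py : T (p y)) →
        Σ (Graph.Walk (InducedAdj p) (x , px) (y , py)) λ w → Graph.len _ w ≡ hamming x y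
climb down [] px py with T-irrelevant px py
... | refl = Graph.[] , refl
climb down (_∷_ {x = false} {xs = xs} 𝔹.f≤t xs≤ys) px py
  with w , len-w ← climb (λ le → down (𝔹.b≤b ∷ le)) xs≤ys (down (𝔹.b≤b ∷ xs≤ys) py) py
  = flip Graph.∷ consʷ true w , cong suc (trans (len-mapʷ _ _ w) len-w)
  where
  flip : hamming (false ∷ xs) (true ∷ xs) ≡ 1
  flip = cong suc (hamming-self xs)
climb down (_∷_ {x = b} {xs = xs} {ys = ys} 𝔹.b≤b xs≤ys) px py
  with w , len-w ← climb (λ le → down (𝔹.b≤b ∷ le)) xs≤ys px py
  = consʷ b w , trans (len-mapʷ _ _ w) (trans len-w (sym (hamming-∷-self b xs ys)))

module Induced {m} (p : Vec Bool m → Bool) where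
  open Graph (InducedAdj p)

  Vertex : Set
  Vertex = InducedVertex p

  dist : Vertex → Vertex → ℕ
  dist u v = hamming (proj₁ u) (proj₁ v)

  dist-self : ∀ u → dist u u ≡ 0
  dist-self u = hamming-self (proj₁ u)

  dist-triangle : ∀ u v w → dist u w ≤ dist u v + dist v w
  dist-triangle u v w = hamming-triangle (proj₁ u) (proj₁ v) (proj₁ w)

  adj-sym : ∀ u v → InducedAdj p u v → InducedAdj p v u
  adj-sym u v e = trans (hamming-sym (proj₁ v) (proj₁ u)) e

  dist-step : ∀ u w → InducedAdj p u w → ∀ z → dist u z ≤ suc (dist w z)
  dist-step u w e z = ≤-trans (dist-triangle u w z) (≤-reflexive (cong (_+ dist w z) e))

  dist≤len : ∀ {u v} (q : Walk u v) → dist u v ≤ len q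
  dist≤len {u}     []                = ≤-reflexive (dist-self u)
  dist≤len {u} {v} (_∷_ {w = w} e q) = ≤-trans (dist-step u w e v) (s≤s (dist≤len q))

  geodesic : DownClosed p → ∀ u v → Σ (Walk u v) λ q → len q ≡ dist u v
  geodesic down (x , px) (y , py)
    with q₁ , len-q₁ ← climb down (meet≤ˡ x y) (down (meet≤ˡ x y) px) px
       | q₂ , len-q₂ ← climb down (meet≤ʳ x y) (down (meet≤ˡ x y) px) py
    = reverseʷ adj-sym q₁ ++ʷ q₂ , (begin
      len (reverseʷ adj-sym q₁ ++ʷ q₂)
        ≡⟨ len-++ʷ (reverseʷ adj-sym q₁) q₂ ⟩
      len (reverseʷ adj-sym q₁) + len q₂
        ≡⟨ cong₂ _+_ (trans (len-reverseʷ adj-sym q₁) len-q₁) len-q₂ ⟩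
      hamming (zipWith _∧_ x y) x + hamming (zipWith _∧_ x y) y
        ≡⟨ hamming-meet x y ⟩
      hamming x y
        ∎)
    where open ≡-Reasoning

  shortest⇒len≤dist : DownClosed p → ∀ {u v} {q : Walk u v} → IsShortest q → len q ≤ dist u v
  shortest⇒len≤dist down {u} {v} shortest with q , len-q ← geodesic down u v
    = ≤-trans (shortest q) (≤-reflexive len-q)

  len≡dist⇒shortest : ∀ {u v} {q : Walk u v} → len q ≡ dist u v → IsShortest q
  len≡dist⇒shortest len≡ r = ≤-trans (≤-reflexive len≡) (dist≤len r)

  Arc : Set
  Arc = Vertex × Vertex

  tourLength : Vertex → List Arc → Vertex → ℕ
  tourLength u []            v = dist u v
  tourLength u ((x , y) ∷ L) v = dist u x + suc (tourLength y L v)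

  tourLength-step : ∀ u w → InducedAdj p u w → ∀ L v → tourLength u L v ≤ suc (tourLength w L v)
  tourLength-step u w e []            v = dist-step u w e v
  tourLength-step u w e ((x , y) ∷ L) v = +-monoˡ-≤ (suc (tourLength y L v)) (dist-step u w e x)

  tourLength≤len : ∀ {u v L} {q : Walk u v} → TraversesInOrder L q → tourLength u L v ≤ len q
  tourLength≤len {q = q} [] = dist≤len q
  tourLength≤len {u} {v} {L} (skip {w = w} {e = e} ts) =
    ≤-trans (tourLength-step u w e L v) (s≤s (tourLength≤len ts))
  tourLength≤len {u} (take ts) =
    ≤-trans (≤-reflexive (cong (_+ _) (dist-self u))) (s≤s (tourLength≤len ts))

  lastTarget : Vertex → List Arc → Vertex
  lastTarget y []            = y
  lastTarget _ ((_ , y) ∷ L) = lastTarget y L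

  tourLength-via-lastTarget : ∀ y L v →
                              tourLength y L v ≡ tourLength y L (lastTarget y L) + dist (lastTarget y L) v
  tourLength-via-lastTarget y []             v = cong (_+ dist y v) (sym (dist-self y))
  tourLength-via-lastTarget y ((x , y′) ∷ L) v = begin
    dist y x + suc (tourLength y′ L v)
      ≡⟨ cong (λ t → dist y x + suc t) (tourLength-via-lastTarget y′ L v) ⟩
    dist y x + (suc (tourLength y′ L z) + dist z v)
      ≡⟨ +-assoc (dist y x) _ _ ⟨
    dist y x + suc (tourLength y′ L z) + dist z v
      ∎
    where
    open ≡-Reasoning
    z : Vertex
    z = lastTarget y′ L

  -- For L = (x₁,y₁) … (xₖ,yₖ): 1 + d(y₁,x₂) + 1 + … + d(yₖ₋₁,xₖ) + 1 ≤ d(x₁,yₖ).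
  Fits : List Arc → Set
  Fits []            = ⊤
  Fits ((x , y) ∷ L) = suc (tourLength y L (lastTarget y L)) ≤ dist x (lastTarget y L)

  fits? : ∀ L → Dec (Fits L)
  fits? []            = yes tt
  fits? ((x , y) ∷ L) = _ ≤? _

  shortest-inOrder⇒fits : DownClosed p → ∀ {u v L} {q : Walk u v} →
                          IsShortest q → TraversesInOrder L q → Fits L
  shortest-inOrder⇒fits down {L = []} shortest ts = tt
  shortest-inOrder⇒fits down {u} {v} {(x , y) ∷ L} {q} shortest ts =
    +-cancelʳ-≤ (dist z v) _ _ (+-cancelˡ-≤ (dist u x) _ _ (begin
      dist u x + (suc (tourLength y L z) + dist z v)
        ≡⟨ cong (λ t → dist u x + suc t) (tourLength-via-lastTarget y L v) ⟨
      tourLength u ((x , y) ∷ L) v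
        ≤⟨ tourLength≤len ts ⟩
      len q
        ≤⟨ shortest⇒len≤dist down shortest ⟩
      dist u v
        ≤⟨ dist-triangle u x v ⟩
      dist u x + dist x v
        ≤⟨ +-monoʳ-≤ (dist u x) (dist-triangle x z v) ⟩
      dist u x + (dist x z + dist z v)
        ∎))
    where
    open ≤-Reasoning
    z : Vertex
    z = lastTarget y L

  arcs : Edge → List Arc
  arcs ((a , b) , _) = (a , b) ∷ (b , a) ∷ []

  onWalk⇒traversed-arc : ∀ e {u v} {q : Walk u v} → OnWalk e q →
                         Any (λ (a , b) → Traverses a b q) (arcs e)
  onWalk⇒traversed-arc e (inj₁ t) = here t
  onWalk⇒traversed-arc e (inj₂ t) = there (here t)

  arcs-distinct : ∀ e f → ¬ SameEdge e f → ∀ {A B} → A ∈ arcs e → B ∈ arcs f → A ≢ B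
  arcs-distinct e f e≉f (here refl)         (here refl)         refl = e≉f (inj₁ (refl , refl))
  arcs-distinct e f e≉f (here refl)         (there (here refl)) refl = e≉f (inj₂ (refl , refl))
  arcs-distinct e f e≉f (there (here refl)) (here refl)         refl = e≉f (inj₂ (refl , refl))
  arcs-distinct e f e≉f (there (here refl)) (there (here refl)) refl = e≉f (inj₁ (refl , refl))

  Aligned : Edge → Edge → Edge → Set
  Aligned e f g =
    Any (λ A → Any (λ B → Any (λ C → Any Fits (orderings (A ∷ B ∷ C ∷ []))) (arcs g)) (arcs f)) (arcs e)

  aligned? : ∀ e f g → Dec (Aligned e f g)
  aligned? e f g = Any.any? (λ A → Any.any? (λ B → Any.any? (λ C →
                     Any.any? fits? (orderings (A ∷ B ∷ C ∷ []))) (arcs g)) (arcs f)) (arcs e)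

  shortest⇒aligned : DownClosed p → ∀ e f g → ¬ SameEdge e f → ¬ SameEdge e g → ¬ SameEdge f g →
                     ∀ {u v} {q : Walk u v} → IsShortest q → OnWalk e q → OnWalk f q → OnWalk g q →
                     Aligned e f g
  shortest⇒aligned down e f g e≉f e≉g f≉g shortest on-e on-f on-g
    with A , A∈ , tA ← find (onWalk⇒traversed-arc e on-e)
       | B , B∈ , tB ← find (onWalk⇒traversed-arc f on-f)
       | C , C∈ , tC ← find (onWalk⇒traversed-arc g on-g)
    = lose A∈ (lose B∈ (lose C∈ (Any.map (shortest-inOrder⇒fits down shortest)
        (inOrder-some-ordering (tA ∷ tB ∷ tC ∷ []) distinct))))
    where
    distinct : AllPairs _≢_ (A ∷ B ∷ C ∷ [])
    distinct = (arcs-distinct e f e≉f A∈ B∈ ∷ arcs-distinct e g e≉g A∈ C∈ ∷ [])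
             ∷ (arcs-distinct f g f≉g B∈ C∈ ∷ []) ∷ [] ∷ []

  edgeGP-if-no-three-aligned :
    DownClosed p → (X : EdgeSet) →
    (∀ i j k → i ≢ j → j ≢ k → i ≢ k → ¬ Aligned (lookup (proj₁ X) i) (lookup (proj₁ X) j) (lookup (proj₁ X) k)) →
    IsEdgeGP X
  edgeGP-if-no-three-aligned down (X , distinct) none i j k i≢j j≢k i≢k (_ , _ , _ , shortest , on-i , on-j , on-k) =
    none i j k i≢j j≢k i≢k
      (shortest⇒aligned down (lookup X i) (lookup X j) (lookup X k) (≉ i≢j) (≉ i≢k) (≉ j≢k) shortest on-i on-j on-k)
    where
    ≉ : ∀ {a b} → a ≢ b → ¬ SameEdge (lookup X a) (lookup X b)
    ≉ = allPairs-lookup (λ {e} {f} e≉f f≈e → e≉f (SameEdge-sym f e f≈e)) distinct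

  ≡-vertex : ∀ {x y} {px : T (p x)} {py : T (p y)} → x ≡ y → (Vertex ∋ (x , px)) ≡ (y , py)
  ≡-vertex refl = cong (_ ,_) (T-irrelevant _ _)

  _≟ᵥ_ : DecidableEquality Vertex
  (x , px) ≟ᵥ (y , py) = map′ ≡-vertex (cong proj₁) (Vec.≡-dec 𝔹._≟_ x y)

  ∀-vertex? : ∀ {Q : Vertex → Set} → (∀ v → Dec (Q v)) → Dec (∀ v → Q v)
  ∀-vertex? Q? = map′ (λ h v → h (proj₁ v) (proj₂ v)) (λ h x px → h (x , px))
                      (∀-Vec? λ x → Π? (T? (p x)) T-irrelevant λ px → Q? (x , px))

  ∀-edge? : ∀ {Q : Edge → Set} → (∀ e → Dec (Q e)) → Dec (∀ e → Q e)
  ∀-edge? Q? = map′ (λ h e → h (proj₁ (proj₁ e)) (proj₂ (proj₁ e)) (proj₂ e)) (λ h a b adj → h ((a , b) , adj))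
                    (∀-vertex? λ a → ∀-vertex? λ b → Π? (dist a b ≟ℕ 1) ≡-irrelevant λ adj → Q? ((a , b) , adj))

-- Lucas cubes

nand-antitone : ∀ {a b a′ b′} → a 𝔹.≤ b → a′ 𝔹.≤ b′ → T (not (b ∧ b′)) → T (not (a ∧ a′))
nand-antitone {false}             _     _     _ = tt
nand-antitone {true} {a′ = false} _     _     _ = tt
nand-antitone {true} {a′ = true}  𝔹.b≤b 𝔹.b≤b t = t

noAdj11-∷∷ : ∀ {m} a b (xs : Vec Bool m) → noAdj11 (a ∷ b ∷ xs) ≡ not (a ∧ b) ∧ noAdj11 (b ∷ xs)
noAdj11-∷∷ false b     xs = refl
noAdj11-∷∷ true  false xs = refl
noAdj11-∷∷ true  true  xs = refl

noAdj11-downClosed : ∀ {m} → DownClosed (noAdj11 {m})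
noAdj11-downClosed []       _ = tt
noAdj11-downClosed (_ ∷ []) _ = tt
noAdj11-downClosed {x = a ∷ a′ ∷ xs} {y = b ∷ b′ ∷ ys} (a≤b ∷ tail≤@(a′≤b′ ∷ _)) t =
  subst T (sym (noAdj11-∷∷ a a′ xs))
    (Equivalence.from T-∧ (nand-antitone a≤b a′≤b′ (proj₁ parts) , noAdj11-downClosed tail≤ (proj₂ parts)))
  where
  parts : T (not (b ∧ b′)) × T (noAdj11 (b′ ∷ ys))
  parts = Equivalence.to T-∧ (subst T (noAdj11-∷∷ b b′ ys) t)

last-mono : ∀ {m} {x y : Vec Bool (suc m)} → x ≤ᵛ y → last x 𝔹.≤ last y
last-mono (a≤b ∷ [])       = a≤b
last-mono (_ ∷ le@(_ ∷ _)) = last-mono le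

isLucas-downClosed : ∀ {n} → DownClosed (isLucas {n})
isLucas-downClosed le@(a≤b ∷ _) t
  with noAdj , ends ← Equivalence.to T-∧ t
  = Equivalence.from T-∧ (noAdj11-downClosed le noAdj , nand-antitone a≤b (last-mono le) ends)

-- Λ₅

open Graph Λ₅Adj
open Induced (isLucas {4})

v00000 v00001 v00010 v00100 v00101 v01000 v01001 v01010 v10000 v10010 v10100 : LucasVertex 4
v00000 = (false ∷ false ∷ false ∷ false ∷ false ∷ []) , tt
v00001 = (false ∷ false ∷ false ∷ false ∷ true  ∷ []) , tt
v00010 = (false ∷ false ∷ false ∷ true  ∷ false ∷ []) , tt
v00100 = (false ∷ false ∷ true  ∷ false ∷ false ∷ []) , tt
v00101 = (false ∷ false ∷ true  ∷ false ∷ true  ∷ []) , tt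
v01000 = (false ∷ true  ∷ false ∷ false ∷ false ∷ []) , tt
v01001 = (false ∷ true  ∷ false ∷ false ∷ true  ∷ []) , tt
v01010 = (false ∷ true  ∷ false ∷ true  ∷ false ∷ []) , tt
v10000 = (true  ∷ false ∷ false ∷ false ∷ false ∷ []) , tt
v10010 = (true  ∷ false ∷ false ∷ true  ∷ false ∷ []) , tt
v10100 = (true  ∷ false ∷ true  ∷ false ∷ false ∷ []) , tt

infixr 5 _⇒_
infix  6 _∎

_⇒_ : ∀ (u : LucasVertex 4) {w v} → Walk w v → {T (dist u w ≡ᵇ 1)} → Walk u v
(u ⇒ q) {adj} = ≡ᵇ⇒≡ _ 1 adj ∷ q

_∎ : ∀ (v : LucasVertex 4) → Walk v v
v ∎ = []

edge : ∀ (u v : LucasVertex 4) → {T (dist u v ≡ᵇ 1)} → Edge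
edge u v {adj} = (u , v) , ≡ᵇ⇒≡ _ 1 adj

X₇ : List Edge
X₇ = edge v00000 v00001 ∷ edge v00000 v00010 ∷ edge v00000 v00100
   ∷ edge v01000 v01001 ∷ edge v01000 v01010 ∷ edge v10000 v10010 ∷ edge v10000 v10100 ∷ []

X₇-distinct : AllPairs (λ e f → ¬ SameEdge e f) X₇
X₇-distinct = from-yes (allPairs? (λ e f → ¬? (sameEdge? _≟ᵥ_ e f)) X₇)

X₇-edgeGP : IsEdgeGP (X₇ , X₇-distinct)
X₇-edgeGP = edgeGP-if-no-three-aligned isLucas-downClosed (X₇ , X₇-distinct) (from-yes
  (Fin.all? λ i → Fin.all? λ j → Fin.all? λ k →
     ¬? (i Fin.≟ j) →-dec ¬? (j Fin.≟ k) →-dec ¬? (i Fin.≟ k) →-dec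
     ¬? (aligned? (lookup X₇ i) (lookup X₇ j) (lookup X₇ k))))

geodesics : List (Route {Adj = Λ₅Adj})
geodesics =
    ⟨ v00101 ⇒ v00100 ⇒ v00000 ⇒ v01000 ⇒ v01010 ∎ ⟩
  ∷ ⟨ v00101 ⇒ v00100 ⇒ v00000 ⇒ v00010 ⇒ v01010 ∎ ⟩
  ∷ ⟨ v00101 ⇒ v00001 ⇒ v00000 ⇒ v01000 ⇒ v01010 ∎ ⟩
  ∷ ⟨ v00101 ⇒ v00001 ⇒ v00000 ⇒ v00010 ⇒ v01010 ∎ ⟩
  ∷ ⟨ v00101 ⇒ v00100 ⇒ v00000 ⇒ v10000 ⇒ v10010 ∎ ⟩
  ∷ ⟨ v00101 ⇒ v00100 ⇒ v00000 ⇒ v00010 ⇒ v10010 ∎ ⟩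
  ∷ ⟨ v00101 ⇒ v00001 ⇒ v00000 ⇒ v10000 ⇒ v10010 ∎ ⟩
  ∷ ⟨ v00101 ⇒ v00001 ⇒ v00000 ⇒ v00010 ⇒ v10010 ∎ ⟩
  ∷ ⟨ v01001 ⇒ v01000 ⇒ v00000 ⇒ v10000 ⇒ v10010 ∎ ⟩
  ∷ ⟨ v01001 ⇒ v01000 ⇒ v00000 ⇒ v00010 ⇒ v10010 ∎ ⟩
  ∷ ⟨ v01001 ⇒ v00001 ⇒ v00000 ⇒ v10000 ⇒ v10010 ∎ ⟩
  ∷ ⟨ v01001 ⇒ v00001 ⇒ v00000 ⇒ v00010 ⇒ v10010 ∎ ⟩
  ∷ ⟨ v01001 ⇒ v01000 ⇒ v00000 ⇒ v10000 ⇒ v10100 ∎ ⟩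
  ∷ ⟨ v01001 ⇒ v01000 ⇒ v00000 ⇒ v00100 ⇒ v10100 ∎ ⟩
  ∷ ⟨ v01001 ⇒ v00001 ⇒ v00000 ⇒ v10000 ⇒ v10100 ∎ ⟩
  ∷ ⟨ v01001 ⇒ v00001 ⇒ v00000 ⇒ v00100 ⇒ v10100 ∎ ⟩
  ∷ ⟨ v01010 ⇒ v01000 ⇒ v00000 ⇒ v10000 ⇒ v10100 ∎ ⟩
  ∷ ⟨ v01010 ⇒ v01000 ⇒ v00000 ⇒ v00100 ⇒ v10100 ∎ ⟩
  ∷ ⟨ v01010 ⇒ v00010 ⇒ v00000 ⇒ v10000 ⇒ v10100 ∎ ⟩
  ∷ ⟨ v01010 ⇒ v00010 ⇒ v00000 ⇒ v00100 ⇒ v10100 ∎ ⟩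
  ∷ rim ++ rim
  where
  rim : List (Route {Adj = Λ₅Adj})
  rim = ⟨ v00101 ⇒ v00001 ⇒ v01001 ⇒ v01000 ⇒ v01010 ∎ ⟩
      ∷ ⟨ v00101 ⇒ v00100 ⇒ v10100 ⇒ v10000 ⇒ v10010 ∎ ⟩
      ∷ ⟨ v01001 ⇒ v01000 ⇒ v01010 ⇒ v00010 ⇒ v10010 ∎ ⟩
      ∷ ⟨ v01001 ⇒ v00001 ⇒ v00101 ⇒ v00100 ⇒ v10100 ∎ ⟩
      ∷ ⟨ v01010 ⇒ v00010 ⇒ v10010 ⇒ v10000 ⇒ v10100 ∎ ⟩
      ∷ []

geodesics-shortest : All (IsShortest ∘ Route.walk) geodesics
geodesics-shortest = All.map len≡dist⇒shortest
  (from-yes (All.all? (λ r → len (Route.walk r) ≟ℕ dist (Route.start r) (Route.end r)) geodesics))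

geodesics-cover : ∀ e → 8 ≤ count (λ r → onWalk? _≟ᵥ_ e (Route.walk r)) geodesics
geodesics-cover = from-yes (∀-edge? λ e → 8 ≤? count (λ r → onWalk? _≟ᵥ_ e (Route.walk r)) geodesics)

proposition4p7 : Graph.GpE≡ Λ₅Adj 7
proposition4p7 = ((X₇ , X₇-distinct) , X₇-edgeGP , refl) , λ X gp →
  s≤s⁻¹ (*-cancelʳ-< 8 (card X) 8
    (≤-<-trans (cover-bound _≟ᵥ_ geodesics geodesics-shortest geodesics-cover X gp) (from-yes (60 <? 64))))
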